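{- For all terms $P,P'\in\widehat{\mathcal P}$: if $P\xrightarrow{\sigma}_2P'$ then $P'\succeq^{+}P$.
   Context: TACS. Fix a countable set $\Lambda$ of action names; $\overline{\Lambda}=\{\overline a : a\in\Lambda\}$ with $\overline{\overline a}=a$; $\mathcal A=\Lambda\cup\overline\Lambda\cup\{\tau\}$, and $a$ ranges over $\Lambda\cup\overline\Lambda$. Terms (set $\widehat{\mathcal P}$, possibly open) are generated by $P::=\mathbf 0\mid x\mid \alpha.P\mid \sigma.P\mid P+P\mid P|P\mid P\backslash L\mid P[f]\mid \mu x.P$, where $\alpha\in\mathcal A$, $x$ ranges over a countably infinite set of variables, $L\subseteq\mathcal A\setminus\{\tau\}$ is finite, and $f:\mathcal A\to\mathcal A$ satisfies $f(\tau)=\tau$, $f(\overline a)=\overline{f(a)}$ and $f(\alpha)\neq\alpha$ for only finitely many $\alpha$. $\mu x$ binds $x$; $P[Q/x]$ is substitution of $Q$ for the free occurrences of $x$. A variable is guarded in a term if each of its occurrences is in the scope of an action prefix $\alpha.\_$ (a $\sigma$-prefix does not count); in every term $\mu x.P$, $x$ must be guarded in $P$. $\overline L=\{\overline a: a\in L\}$. Urgent sets: $\mathcal U(\sigma.P)=\mathcal U(\mathbf 0)=\mathcal U(x)=\emptyset$, $\mathcal U(\alpha.P)=\{\alpha\}$, $\mathcal U(P+Q)=\mathcal U(P)\cup\mathcal U(Q)$, $\mathcal U(P|Q)=\mathcal U(P)\cup\mathcal U(Q)\cup\{\tau\mid \mathcal U(P)\cap\overline{\mathcal U(Q)}\neq\emptyset\}$,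 $\mathcal U(P\backslash L)=\mathcal U(P)\setminus(L\cup\overline L)$, $\mathcal U(P[f])=\{f(\alpha):\alpha\in\mathcal U(P)\}$, $\mathcal U(\mu x.P)=\mathcal U(P)$. The clock transition relation $\xrightarrow{\sigma}_2$ on terms is the least relation with: $\mathbf 0\xrightarrow{\sigma}_2\mathbf 0$; $a.P\xrightarrow{\sigma}_2 a.P$ for $a\in\Lambda\cup\overline\Lambda$; $\sigma.P\xrightarrow{\sigma}_2P$; if $P\xrightarrow{\sigma}_2P'$ then $\sigma.P\xrightarrow{\sigma}_2P'$, $\mu x.P\xrightarrow{\sigma}_2P'[\mu x.P/x]$, $P\backslash L\xrightarrow{\sigma}_2P'\backslash L$, $P[f]\xrightarrow{\sigma}_2P'[f]$; if $P\xrightarrow{\sigma}_2P'$ and $Q\xrightarrow{\sigma}_2Q'$ then $P+Q\xrightarrow{\sigma}_2P'+Q'$, and $P|Q\xrightarrow{\sigma}_2P'|Q'$ provided $\tau\notin\mathcal U(P|Q)$. The syntactic relation $\succeq\subseteq\widehat{\mathcal P}\times\widehat{\mathcal P}$ is the smallest relation such that for all terms: $P\succeq P$; $P\succeq\sigma.P$; if $P'\succeq P$ and $Q'\succeq Q$ then $P'|Q'\succeq P|Q$ and $P'+Q'\succeq P+Q$; if $P'\succeq P$ then $P'\backslash L\succeq P\backslash L$ and $P'[f]\succeq P[f]$; if $P'\succeq P$ and $x$ is guarded in $P$ then $P'[\mu x.P/x]\succeq\mu x.P$. $\succeq^{+}$ denotes the transitive closure of $\succeq$. -}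

module Defs where

open import Data.Nat using (ℕ; zero; suc)
open import Data.List using (List)
open import Data.List.Membership.Propositional using (_∈_; _∉_)
open import Data.Product using (Σ; ∃; _×_; _,_)
open import Data.Sum using (_⊎_)
open import Data.Empty using (⊥)
open import Relation.Nullary using (¬_)
open import Relation.Binary.PropositionalEquality using (_≡_)
open import Relation.Binary.Construct.Closure.Transitive using (TransClosure)

data Label : Set where
  name   : ℕ → Label
  coname : ℕ → Label

bar : Label → Label
bar (name n)   = coname n
bar (coname n) = name n

data Act : Set where
  lab : Label → Act
  τ   : Act

-- Relabelling functions f : 𝒜 → 𝒜 with f τ = τ, f (ā) = \overline{f a},
-- and f α ≠ α for only finitely many α.  Since f τ = τ is forced, f is
-- given by its action on labels (extended by τ ↦ τ).

record Relabelling : Set where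
  field
    fn      : Label → Label
    fn-bar  : ∀ a → fn (bar a) ≡ bar (fn a)
    support : List Label
    finite  : ∀ a → a ∉ support → fn a ≡ a

applyR : Relabelling → Act → Act
applyR f (lab a) = lab (Relabelling.fn f a)
applyR f τ       = τ

-- Terms (possibly open), with variables as de Bruijn indices;
-- μ binds index 0.  Restriction sets L ⊆ 𝒜 ∖ {τ} are finite lists of labels.

data Term : Set where
  𝟎     : Term
  var   : ℕ → Term
  _∙_   : Act → Term → Term
  σ∙_   : Term → Term
  _⊕_   : Term → Term → Term
  _∥_   : Term → Term → Term
  _∖_   : Term → List Label → Term
  _[_]ʳ : Term → Relabelling → Term
  μ_    : Term → Term

ext : (ℕ → ℕ) → ℕ → ℕ
ext ρ zero    = zero
ext ρ (suc n) = suc (ρ n)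

rename : (ℕ → ℕ) → Term → Term
rename ρ 𝟎         = 𝟎
rename ρ (var n)   = var (ρ n)
rename ρ (α ∙ P)   = α ∙ rename ρ P
rename ρ (σ∙ P)    = σ∙ rename ρ P
rename ρ (P ⊕ Q)   = rename ρ P ⊕ rename ρ Q
rename ρ (P ∥ Q)   = rename ρ P ∥ rename ρ Q
rename ρ (P ∖ L)   = rename ρ P ∖ L
rename ρ (P [ f ]ʳ) = rename ρ P [ f ]ʳ
rename ρ (μ P)     = μ rename (ext ρ) P

exts : (ℕ → Term) → ℕ → Term
exts s zero    = var zero
exts s (suc n) = rename suc (s n)

subst : (ℕ → Term) → Term → Term
subst s 𝟎          = 𝟎
subst s (var n)    = s n
subst s (α ∙ P)    = α ∙ subst s P
subst s (σ∙ P)     = σ∙ subst s P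
subst s (P ⊕ Q)    = subst s P ⊕ subst s Q
subst s (P ∥ Q)    = subst s P ∥ subst s Q
subst s (P ∖ L)    = subst s P ∖ L
subst s (P [ f ]ʳ) = subst s P [ f ]ʳ
subst s (μ P)      = μ subst (exts s) P

single : Term → ℕ → Term
single Q zero    = Q
single Q (suc n) = var n

_[_/0] : Term → Term → Term
P [ Q /0] = subst (single Q) P

-- Guardedness: variable n occurs unguarded in P if some occurrence is not
-- in the scope of an action prefix (σ-prefixes do not guard).

data Unguarded : ℕ → Term → Set where
  ug-var  : ∀ {n} → Unguarded n (var n)
  ug-σ    : ∀ {n P} → Unguarded n P → Unguarded n (σ∙ P)
  ug-+ˡ   : ∀ {n P Q} → Unguarded n P → Unguarded n (P ⊕ Q)
  ug-+ʳ   : ∀ {n P Q} → Unguarded n Q → Unguarded n (P ⊕ Q)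
  ug-|ˡ   : ∀ {n P Q} → Unguarded n P → Unguarded n (P ∥ Q)
  ug-|ʳ   : ∀ {n P Q} → Unguarded n Q → Unguarded n (P ∥ Q)
  ug-∖    : ∀ {n P L} → Unguarded n P → Unguarded n (P ∖ L)
  ug-[]   : ∀ {n P f} → Unguarded n P → Unguarded n (P [ f ]ʳ)
  ug-μ    : ∀ {n P} → Unguarded (suc n) P → Unguarded n (μ P)

Guarded : ℕ → Term → Set
Guarded n P = ¬ Unguarded n P

data WF : Term → Set where
  wf-𝟎   : WF 𝟎
  wf-var : ∀ {n} → WF (var n)
  wf-act : ∀ {α P} → WF P → WF (α ∙ P)
  wf-σ   : ∀ {P} → WF P → WF (σ∙ P)
  wf-+   : ∀ {P Q} → WF P → WF Q → WF (P ⊕ Q)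
  wf-|   : ∀ {P Q} → WF P → WF Q → WF (P ∥ Q)
  wf-∖   : ∀ {P L} → WF P → WF (P ∖ L)
  wf-[]  : ∀ {P f} → WF P → WF (P [ f ]ʳ)
  wf-μ   : ∀ {P} → Guarded 0 P → WF P → WF (μ P)

InRes : Act → List Label → Set
InRes α L = ∃ λ a → a ∈ L × (α ≡ lab a ⊎ α ≡ lab (bar a))

𝒰 : Term → Act → Set
𝒰 𝟎          β = ⊥
𝒰 (var n)    β = ⊥
𝒰 (α ∙ P)    β = β ≡ α
𝒰 (σ∙ P)     β = ⊥
𝒰 (P ⊕ Q)    β = 𝒰 P β ⊎ 𝒰 Q β
𝒰 (P ∥ Q)    β = 𝒰 P β ⊎ 𝒰 Q β
                 ⊎ (β ≡ τ × ∃ λ a → 𝒰 P (lab a) × 𝒰 Q (lab (bar a)))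
𝒰 (P ∖ L)    β = 𝒰 P β × ¬ InRes β L
𝒰 (P [ f ]ʳ) β = ∃ λ α → 𝒰 P α × applyR f α ≡ β
𝒰 (μ P)      β = 𝒰 P β

data _—σ→₂_ : Term → Term → Set where
  c-𝟎   : 𝟎 —σ→₂ 𝟎
  c-act : ∀ {a P} → (lab a ∙ P) —σ→₂ (lab a ∙ P)
  c-σ   : ∀ {P} → (σ∙ P) —σ→₂ P
  c-σ′  : ∀ {P P'} → P —σ→₂ P' → (σ∙ P) —σ→₂ P'
  c-μ   : ∀ {P P'} → P —σ→₂ P' → (μ P) —σ→₂ (P' [ μ P /0])
  c-∖   : ∀ {P P' L} → P —σ→₂ P' → (P ∖ L) —σ→₂ (P' ∖ L)
  c-[]  : ∀ {P P' f} → P —σ→₂ P' → (P [ f ]ʳ) —σ→₂ (P' [ f ]ʳ)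
  c-+   : ∀ {P P' Q Q'} → P —σ→₂ P' → Q —σ→₂ Q' → (P ⊕ Q) —σ→₂ (P' ⊕ Q')
  c-|   : ∀ {P P' Q Q'} → P —σ→₂ P' → Q —σ→₂ Q' → ¬ 𝒰 (P ∥ Q) τ
          → (P ∥ Q) —σ→₂ (P' ∥ Q')

data _⪰_ : Term → Term → Set where
  ⪰-refl : ∀ {P} → P ⪰ P
  ⪰-σ    : ∀ {P} → P ⪰ (σ∙ P)
  ⪰-|    : ∀ {P P' Q Q'} → P' ⪰ P → Q' ⪰ Q → (P' ∥ Q') ⪰ (P ∥ Q)
  ⪰-+    : ∀ {P P' Q Q'} → P' ⪰ P → Q' ⪰ Q → (P' ⊕ Q') ⪰ (P ⊕ Q)
  ⪰-∖    : ∀ {P P' L} → P' ⪰ P → (P' ∖ L) ⪰ (P ∖ L)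
  ⪰-[]   : ∀ {P P' f} → P' ⪰ P → (P' [ f ]ʳ) ⪰ (P [ f ]ʳ)
  ⪰-μ    : ∀ {P P'} → P' ⪰ P → Guarded 0 P → (P' [ μ P /0]) ⪰ (μ P)

_⪰⁺_ : Term → Term → Set
_⪰⁺_ = TransClosure _⪰_

module Submission where

-- Every rule of —σ→₂ is mirrored by a
-- rule of ⪰, except that σ.P —σ→₂ P' (from P —σ→₂ P') needs the two steps
-- P' ⪰⁺ P ⪰ σ.P, which is why the statement is about ⪰⁺.  In the μ case a
-- chain P' ⪰⁺ P must become P'[μP/0] ⪰⁺ μP: all steps but the last are the
-- chain with μP substituted in, and the last one is the rule ⪰-μ.  This needs
-- ⪰ to be closed under substitution, whose μ case rests on two facts: the
-- substitution lemma for [_/0], and that substituting under a binder keeps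
-- the bound variable guarded.

open import Defs
open import Data.Nat using (zero; suc)
open import Data.Product using (∃-syntax; _×_; _,_; map₁; map₂)
open import Function using (_∘_)
open import Relation.Binary.PropositionalEquality
  using (_≡_; _≗_; refl; cong; cong₂; sym; trans; module ≡-Reasoning)
open import Relation.Binary.Construct.Closure.Transitive using ([_]; _∷_; _++_)

ext-cong : ∀ {ρ ρ'} → ρ ≗ ρ' → ext ρ ≗ ext ρ'
ext-cong e zero    = refl
ext-cong e (suc n) = cong suc (e n)

ext-∘ : ∀ ρ ρ' → ext ρ ∘ ext ρ' ≗ ext (ρ ∘ ρ')
ext-∘ ρ ρ' zero    = refl
ext-∘ ρ ρ' (suc n) = refl

exts-cong : ∀ {s t} → s ≗ t → exts s ≗ exts t
exts-cong e zero    = refl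
exts-cong e (suc n) = cong (rename suc) (e n)

exts-ext : ∀ s ρ → exts s ∘ ext ρ ≗ exts (s ∘ ρ)
exts-ext s ρ zero    = refl
exts-ext s ρ (suc n) = refl

exts-var : exts var ≗ var
exts-var zero    = refl
exts-var (suc n) = refl

rename-cong : ∀ {ρ ρ'} → ρ ≗ ρ' → rename ρ ≗ rename ρ'
rename-cong e 𝟎          = refl
rename-cong e (var n)    = cong var (e n)
rename-cong e (α ∙ P)    = cong (α ∙_) (rename-cong e P)
rename-cong e (σ∙ P)     = cong σ∙_ (rename-cong e P)
rename-cong e (P ⊕ Q)    = cong₂ _⊕_ (rename-cong e P) (rename-cong e Q)
rename-cong e (P ∥ Q)    = cong₂ _∥_ (rename-cong e P) (rename-cong e Q)
rename-cong e (P ∖ L)    = cong (_∖ L) (rename-cong e P)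
rename-cong e (P [ f ]ʳ) = cong (_[ f ]ʳ) (rename-cong e P)
rename-cong e (μ P)      = cong μ_ (rename-cong (ext-cong e) P)

subst-cong : ∀ {s t} → s ≗ t → subst s ≗ subst t
subst-cong e 𝟎          = refl
subst-cong e (var n)    = e n
subst-cong e (α ∙ P)    = cong (α ∙_) (subst-cong e P)
subst-cong e (σ∙ P)     = cong σ∙_ (subst-cong e P)
subst-cong e (P ⊕ Q)    = cong₂ _⊕_ (subst-cong e P) (subst-cong e Q)
subst-cong e (P ∥ Q)    = cong₂ _∥_ (subst-cong e P) (subst-cong e Q)
subst-cong e (P ∖ L)    = cong (_∖ L) (subst-cong e P)
subst-cong e (P [ f ]ʳ) = cong (_[ f ]ʳ) (subst-cong e P)
subst-cong e (μ P)      = cong μ_ (subst-cong (exts-cong e) P)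

rename-rename : ∀ ρ ρ' P → rename ρ (rename ρ' P) ≡ rename (ρ ∘ ρ') P
rename-rename ρ ρ' 𝟎          = refl
rename-rename ρ ρ' (var n)    = refl
rename-rename ρ ρ' (α ∙ P)    = cong (α ∙_) (rename-rename ρ ρ' P)
rename-rename ρ ρ' (σ∙ P)     = cong σ∙_ (rename-rename ρ ρ' P)
rename-rename ρ ρ' (P ⊕ Q)    = cong₂ _⊕_ (rename-rename ρ ρ' P) (rename-rename ρ ρ' Q)
rename-rename ρ ρ' (P ∥ Q)    = cong₂ _∥_ (rename-rename ρ ρ' P) (rename-rename ρ ρ' Q)
rename-rename ρ ρ' (P ∖ L)    = cong (_∖ L) (rename-rename ρ ρ' P)
rename-rename ρ ρ' (P [ f ]ʳ) = cong (_[ f ]ʳ) (rename-rename ρ ρ' P)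
rename-rename ρ ρ' (μ P)      =
  cong μ_ (trans (rename-rename (ext ρ) (ext ρ') P) (rename-cong (ext-∘ ρ ρ') P))

rename-subst : ∀ ρ s P → rename ρ (subst s P) ≡ subst (rename ρ ∘ s) P
rename-subst ρ s 𝟎          = refl
rename-subst ρ s (var n)    = refl
rename-subst ρ s (α ∙ P)    = cong (α ∙_) (rename-subst ρ s P)
rename-subst ρ s (σ∙ P)     = cong σ∙_ (rename-subst ρ s P)
rename-subst ρ s (P ⊕ Q)    = cong₂ _⊕_ (rename-subst ρ s P) (rename-subst ρ s Q)
rename-subst ρ s (P ∥ Q)    = cong₂ _∥_ (rename-subst ρ s P) (rename-subst ρ s Q)
rename-subst ρ s (P ∖ L)    = cong (_∖ L) (rename-subst ρ s P)
rename-subst ρ s (P [ f ]ʳ) = cong (_[ f ]ʳ) (rename-subst ρ s P)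
rename-subst ρ s (μ P)      =
  cong μ_ (trans (rename-subst (ext ρ) (exts s) P) (subst-cong ext-exts P))
  where
  ext-exts : rename (ext ρ) ∘ exts s ≗ exts (rename ρ ∘ s)
  ext-exts zero    = refl
  ext-exts (suc n) = trans (rename-rename (ext ρ) suc (s n)) (sym (rename-rename suc ρ (s n)))

subst-rename : ∀ s ρ P → subst s (rename ρ P) ≡ subst (s ∘ ρ) P
subst-rename s ρ 𝟎          = refl
subst-rename s ρ (var n)    = refl
subst-rename s ρ (α ∙ P)    = cong (α ∙_) (subst-rename s ρ P)
subst-rename s ρ (σ∙ P)     = cong σ∙_ (subst-rename s ρ P)
subst-rename s ρ (P ⊕ Q)    = cong₂ _⊕_ (subst-rename s ρ P) (subst-rename s ρ Q)
subst-rename s ρ (P ∥ Q)    = cong₂ _∥_ (subst-rename s ρ P) (subst-rename s ρ Q)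
subst-rename s ρ (P ∖ L)    = cong (_∖ L) (subst-rename s ρ P)
subst-rename s ρ (P [ f ]ʳ) = cong (_[ f ]ʳ) (subst-rename s ρ P)
subst-rename s ρ (μ P)      =
  cong μ_ (trans (subst-rename (exts s) (ext ρ) P) (subst-cong (exts-ext s ρ) P))

subst-subst : ∀ s t P → subst s (subst t P) ≡ subst (subst s ∘ t) P
subst-subst s t 𝟎          = refl
subst-subst s t (var n)    = refl
subst-subst s t (α ∙ P)    = cong (α ∙_) (subst-subst s t P)
subst-subst s t (σ∙ P)     = cong σ∙_ (subst-subst s t P)
subst-subst s t (P ⊕ Q)    = cong₂ _⊕_ (subst-subst s t P) (subst-subst s t Q)
subst-subst s t (P ∥ Q)    = cong₂ _∥_ (subst-subst s t P) (subst-subst s t Q)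
subst-subst s t (P ∖ L)    = cong (_∖ L) (subst-subst s t P)
subst-subst s t (P [ f ]ʳ) = cong (_[ f ]ʳ) (subst-subst s t P)
subst-subst s t (μ P)      =
  cong μ_ (trans (subst-subst (exts s) (exts t) P) (subst-cong exts-exts P))
  where
  exts-exts : subst (exts s) ∘ exts t ≗ exts (subst s ∘ t)
  exts-exts zero    = refl
  exts-exts (suc n) = trans (subst-rename (exts s) suc (t n)) (sym (rename-subst suc s (t n)))

subst-var : ∀ P → subst var P ≡ P
subst-var 𝟎          = refl
subst-var (var n)    = refl
subst-var (α ∙ P)    = cong (α ∙_) (subst-var P)
subst-var (σ∙ P)     = cong σ∙_ (subst-var P)
subst-var (P ⊕ Q)    = cong₂ _⊕_ (subst-var P) (subst-var Q)
subst-var (P ∥ Q)    = cong₂ _∥_ (subst-var P) (subst-var Q)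
subst-var (P ∖ L)    = cong (_∖ L) (subst-var P)
subst-var (P [ f ]ʳ) = cong (_[ f ]ʳ) (subst-var P)
subst-var (μ P)      = cong μ_ (trans (subst-cong exts-var P) (subst-var P))

subst-[/0] : ∀ s P Q → subst s (P [ Q /0]) ≡ subst (exts s) P [ subst s Q /0]
subst-[/0] s P Q = begin
  subst s (P [ Q /0])                           ≡⟨ subst-subst s (single Q) P ⟩
  subst (subst s ∘ single Q) P                  ≡⟨ subst-cong pointwise P ⟩
  subst (subst (single (subst s Q)) ∘ exts s) P ≡⟨ subst-subst (single (subst s Q)) (exts s) P ⟨
  subst (exts s) P [ subst s Q /0]              ∎
  where
  open ≡-Reasoning
  -- both sides agree on 0, and above 0 the renaming by suc is undone by single
  pointwise : subst s ∘ single Q ≗ subst (single (subst s Q)) ∘ exts s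
  pointwise zero    = refl
  pointwise (suc n) = sym (trans (subst-rename (single (subst s Q)) suc (s n)) (subst-var (s n)))

Unguarded-rename⁻ : ∀ ρ P {n} → Unguarded n (rename ρ P) → ∃[ m ] Unguarded m P × ρ m ≡ n
Unguarded-rename⁻ ρ (var k)    ug-var    = k , ug-var , refl
Unguarded-rename⁻ ρ (σ∙ P)     (ug-σ u)  = map₂ (map₁ ug-σ) (Unguarded-rename⁻ ρ P u)
Unguarded-rename⁻ ρ (P ⊕ Q)    (ug-+ˡ u) = map₂ (map₁ ug-+ˡ) (Unguarded-rename⁻ ρ P u)
Unguarded-rename⁻ ρ (P ⊕ Q)    (ug-+ʳ u) = map₂ (map₁ ug-+ʳ) (Unguarded-rename⁻ ρ Q u)
Unguarded-rename⁻ ρ (P ∥ Q)    (ug-|ˡ u) = map₂ (map₁ ug-|ˡ) (Unguarded-rename⁻ ρ P u)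
Unguarded-rename⁻ ρ (P ∥ Q)    (ug-|ʳ u) = map₂ (map₁ ug-|ʳ) (Unguarded-rename⁻ ρ Q u)
Unguarded-rename⁻ ρ (P ∖ L)    (ug-∖ u)  = map₂ (map₁ ug-∖) (Unguarded-rename⁻ ρ P u)
Unguarded-rename⁻ ρ (P [ f ]ʳ) (ug-[] u) = map₂ (map₁ ug-[]) (Unguarded-rename⁻ ρ P u)
Unguarded-rename⁻ ρ (μ P)      (ug-μ u)  with Unguarded-rename⁻ (ext ρ) P u
... | suc m , v , refl = m , ug-μ v , refl

Unguarded-subst⁻ : ∀ s P {n} → Unguarded n (subst s P) → ∃[ m ] Unguarded m P × Unguarded n (s m)
Unguarded-subst⁻ s (var k)    u         = k , ug-var , u
Unguarded-subst⁻ s (σ∙ P)     (ug-σ u)  = map₂ (map₁ ug-σ) (Unguarded-subst⁻ s P u)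
Unguarded-subst⁻ s (P ⊕ Q)    (ug-+ˡ u) = map₂ (map₁ ug-+ˡ) (Unguarded-subst⁻ s P u)
Unguarded-subst⁻ s (P ⊕ Q)    (ug-+ʳ u) = map₂ (map₁ ug-+ʳ) (Unguarded-subst⁻ s Q u)
Unguarded-subst⁻ s (P ∥ Q)    (ug-|ˡ u) = map₂ (map₁ ug-|ˡ) (Unguarded-subst⁻ s P u)
Unguarded-subst⁻ s (P ∥ Q)    (ug-|ʳ u) = map₂ (map₁ ug-|ʳ) (Unguarded-subst⁻ s Q u)
Unguarded-subst⁻ s (P ∖ L)    (ug-∖ u)  = map₂ (map₁ ug-∖) (Unguarded-subst⁻ s P u)
Unguarded-subst⁻ s (P [ f ]ʳ) (ug-[] u) = map₂ (map₁ ug-[]) (Unguarded-subst⁻ s P u)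
Unguarded-subst⁻ s (μ P)      (ug-μ u)  with Unguarded-subst⁻ (exts s) P u
... | suc m , v , w with Unguarded-rename⁻ suc (s m) w
...   | _ , w' , refl = m , ug-μ v , w'

Guarded-exts : ∀ s P → Guarded 0 P → Guarded 0 (subst (exts s) P)
Guarded-exts s P g u with Unguarded-subst⁻ (exts s) P u
... | zero  , v , _ = g v
... | suc m , _ , w with Unguarded-rename⁻ suc (s m) w
...   | _ , _ , ()

⪰-subst : ∀ s {P' P} → P' ⪰ P → subst s P' ⪰ subst s P
⪰-subst s ⪰-refl    = ⪰-refl
⪰-subst s ⪰-σ       = ⪰-σ
⪰-subst s (⪰-| p q) = ⪰-| (⪰-subst s p) (⪰-subst s q)
⪰-subst s (⪰-+ p q) = ⪰-+ (⪰-subst s p) (⪰-subst s q)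
⪰-subst s (⪰-∖ p)   = ⪰-∖ (⪰-subst s p)
⪰-subst s (⪰-[] p)  = ⪰-[] (⪰-subst s p)
⪰-subst s (⪰-μ {P} {P'} p g) rewrite subst-[/0] s P' (μ P) =
  ⪰-μ (⪰-subst (exts s) p) (Guarded-exts s P g)

⪰⁺-map : (F : Term → Term) → (∀ {A B} → A ⪰ B → F A ⪰ F B) → ∀ {A B} → A ⪰⁺ B → F A ⪰⁺ F B
⪰⁺-map F F-mono [ p ]   = [ F-mono p ]
⪰⁺-map F F-mono (p ∷ c) = F-mono p ∷ ⪰⁺-map F F-mono c

⪰⁺-⊕ : ∀ {P P' Q Q'} → P' ⪰⁺ P → Q' ⪰⁺ Q → (P' ⊕ Q') ⪰⁺ (P ⊕ Q)
⪰⁺-⊕ p q = ⪰⁺-map (_⊕ _) (λ h → ⪰-+ h ⪰-refl) p ++ ⪰⁺-map (_ ⊕_) (⪰-+ ⪰-refl) q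

⪰⁺-∥ : ∀ {P P' Q Q'} → P' ⪰⁺ P → Q' ⪰⁺ Q → (P' ∥ Q') ⪰⁺ (P ∥ Q)
⪰⁺-∥ p q = ⪰⁺-map (_∥ _) (λ h → ⪰-| h ⪰-refl) p ++ ⪰⁺-map (_ ∥_) (⪰-| ⪰-refl) q

⪰⁺-μ : ∀ {P P'} → Guarded 0 P → P' ⪰⁺ P → (P' [ μ P /0]) ⪰⁺ (μ P)
⪰⁺-μ g [ p ]       = [ ⪰-μ p g ]
⪰⁺-μ {P} g (p ∷ c) = ⪰-subst (single (μ P)) p ∷ ⪰⁺-μ g c

—σ→₂⇒⪰⁺ : ∀ {P P'} → WF P → P —σ→₂ P' → P' ⪰⁺ P
—σ→₂⇒⪰⁺ _            c-𝟎         = [ ⪰-refl ]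
—σ→₂⇒⪰⁺ _            c-act       = [ ⪰-refl ]
—σ→₂⇒⪰⁺ _            c-σ         = [ ⪰-σ ]
—σ→₂⇒⪰⁺ (wf-σ w)     (c-σ′ t)    = —σ→₂⇒⪰⁺ w t ++ [ ⪰-σ ]
—σ→₂⇒⪰⁺ (wf-μ g w)   (c-μ t)     = ⪰⁺-μ g (—σ→₂⇒⪰⁺ w t)
—σ→₂⇒⪰⁺ (wf-∖ w)     (c-∖ t)     = ⪰⁺-map (_∖ _) ⪰-∖ (—σ→₂⇒⪰⁺ w t)
—σ→₂⇒⪰⁺ (wf-[] w)    (c-[] t)    = ⪰⁺-map (_[ _ ]ʳ) ⪰-[] (—σ→₂⇒⪰⁺ w t)
—σ→₂⇒⪰⁺ (wf-+ w v)   (c-+ t u)   = ⪰⁺-⊕ (—σ→₂⇒⪰⁺ w t) (—σ→₂⇒⪰⁺ v u)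
—σ→₂⇒⪰⁺ (wf-| w v)   (c-| t u _) = ⪰⁺-∥ (—σ→₂⇒⪰⁺ w t) (—σ→₂⇒⪰⁺ v u)

lemma6 : ∀ {P P'} → WF P → WF P' → P —σ→₂ P' → P' ⪰⁺ P
lemma6 wf _ = —σ→₂⇒⪰⁺ wf
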